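{- Let $m\ge 2$ be an integer with binary expansion $m=a_0+a_12+\cdots+a_k2^k+2^{k+1}$ ($k\ge 0$, $a_\ell\in\{0,1\}$). Put $s=a_0+a_12+\cdots+a_k2^k$ and $t=2^{k+1}-s$. Then $R_{m,m}$ consists of four copies of $R_{s,s}$ placed at the corners and one copy of $R_{t,t}$ placed at the center, i.e. \[ R_{m,m}=R_{s,s}\ \cup\ \bigl(R_{s,s}+(m-s,0)\bigr)\ \cup\ \bigl(R_{s,s}+(0,m-s)\bigr)\ \cup\ \bigl(R_{s,s}+(m-s,m-s)\bigr)\ \cup\ \bigl(R_{t,t}+(s,s)\bigr), \] where $A+(p,q)$ denotes the translate of $A\subset\mathbb{R}^2$ by $(p,q)$ and $R_{0,0}=\emptyset$.
   Context: For a positive integer $m$, the chocolate game $C_{m,m}$ is a two-player impartial game on an $m\times m$ chocolate bar of unit cells, exactly one of which is poisoned (known to both players); cells are $(i,j)\in\mathbb{Z}^2$ with $1\le i,j\le m$. Players alternately break the current bar along a grid line into two rectangular pieces, eat one and pass the other (always keeping the poisoned cell); a player who receives the $1\times1$ bar loses. A cell $(i,j)$ is a P-position if with poison at $(i,j)$ the second player has a winning strategy; $P_{m,m}$ denotes the set of P-positions. It is known that $(i,j)\in P_{m,m}$ iff $(i-1)\oplus(j-1)\oplus(m-i)\oplus(m-j)=0$ ($\oplus$ = bitwise XOR). The pattern is $R_{m,m}=\{(i-x,j-y)\in\mathbb{R}^2: 0\le x,y\le1,\ (i,j)\in P_{m,m}\}$.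
   Formalization: The patterns $R_{m,m}$, $R_{s,s}$, $R_{t,t}$ and their translates are taken as subsets of ℚ² instead of ℝ². -}

module Defs where

open import Data.Bool using (Bool; true; false; if_then_else_)
open import Data.Nat using (ℕ; zero; suc; _+_; _*_; _∸_; _≤_; _≡ᵇ_; ⌊_/2⌋; _%_)
open import Data.Integer using (+_)
open import Data.Rational using (ℚ; _/_) renaming (_≤_ to _≤ℚ_; _-_ to _-ℚ_)
open import Data.Product using (∃₂; _×_)
open import Relation.Binary.PropositionalEquality using (_≡_)

-- Bitwise XOR on ℕ, computed bit by bit (fuel = a + b suffices).
xorFuel : ℕ → ℕ → ℕ → ℕ
xorFuel zero    a b = 0
xorFuel (suc f) a b =
  (if (a % 2) ≡ᵇ (b % 2) then 0 else 1) + 2 * xorFuel f ⌊ a /2⌋ ⌊ b /2⌋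

infixl 6 _⊕_
_⊕_ : ℕ → ℕ → ℕ
a ⊕ b = xorFuel (a + b) a b

ℚ[_] : ℕ → ℚ
ℚ[ n ] = + n / 1

-- (i , j) ∈ P_{m,m}: a cell of the m × m bar which is a P-position,
-- via the known characterisation (i-1)⊕(j-1)⊕(m-i)⊕(m-j) = 0.
P : ℕ → ℕ → ℕ → Set
P m i j = (1 ≤ i) × (i ≤ m) × (1 ≤ j) × (j ≤ m)
        × ((i ∸ 1) ⊕ (j ∸ 1) ⊕ (m ∸ i) ⊕ (m ∸ j) ≡ 0)

R : ℕ → ℚ → ℚ → Set
R m x y = ∃₂ λ i j → P m i j
        × (ℚ[ i ] -ℚ ℚ[ 1 ] ≤ℚ x) × (x ≤ℚ ℚ[ i ])
        × (ℚ[ j ] -ℚ ℚ[ 1 ] ≤ℚ y) × (y ≤ℚ ℚ[ j ])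

_+[_,_] : (ℚ → ℚ → Set) → ℕ → ℕ → (ℚ → ℚ → Set)
(A +[ p , q ]) x y = A (x -ℚ ℚ[ p ]) (y -ℚ ℚ[ q ])

{-# OPTIONS --safe #-}
module Submission where

-- Write g n i = (i - 1) ⊕ (n - i) (sideXor below), so that (i , j) ∈ P_{n,n}
-- iff g n i = g n j.  Let N = 2^(k+1), so that m = s + N and t = N - s.
-- A row i ≤ s of the m-bar is at distances i - 1 and N + (s - i) from the two
-- sides, a row N + i at distances N + (i - 1) and s - i.  All other numbers
-- involved are below N, so adding N is xoring it in, and both rows get value
-- N + g s i.
-- A row s + i with 1 ≤ i ≤ t is at distances s + (i - 1) and s + (t - i);
-- since (i - 1) + s + (t - i) = N - 1, these are the bitwise complements in
-- N - 1 of t - i and i - 1, so g m (s + i) = g t i < N.  Hence g m i = g m j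
-- forces either both rows to be outer, and then the cell is a corner copy of
-- a P-position of the s-bar, or both to be inner, and then it is a central
-- copy of a P-position of the t-bar.  Translating unit squares turns this
-- into the decomposition of R_{m,m}.

open import Algebra.Bundles using (AbelianGroup)
open import Algebra.Consequences.Propositional using (comm∧idʳ⇒id; comm∧invʳ⇒inv)
import Algebra.Properties.AbelianGroup as AbelianGroupProperties
import Algebra.Properties.CommutativeSemigroup as CommutativeSemigroupProperties
open import Data.Bool using (Bool; true; false; if_then_else_)
open import Data.Empty using (⊥-elim)
import Data.Integer.Base as ℤ
import Data.Integer.Properties as ℤ
open import Data.Nat
open import Data.Nat.DivMod using (m%n<n)
open import Data.Nat.Properties
open import Data.Nat.Tactic.RingSolver using (solve-∀)
open import Data.Product using (_×_; _,_; proj₁; proj₂; ∃₂)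
import Data.Product.Function.Dependent.Propositional as Σ
open import Data.Product.Function.NonDependent.Propositional using (_×-⇔_)
open import Data.Rational using (ℚ; toℚᵘ)
  renaming (_+_ to _+ℚ_; _-_ to _-ℚ_; -_ to -ℚ_; _≤_ to _≤ℚ_)
import Data.Rational.Properties as ℚ
open import Data.Rational.Unnormalised as ℚᵘ using (mkℚᵘ; *≡*)
import Data.Rational.Unnormalised.Properties as ℚᵘ
open import Data.Sum using (_⊎_; inj₁; inj₂)
open import Function using (id)
open import Function.Bundles using (_⇔_; mk⇔; Equivalence)
open Equivalence using (to; from)
open import Function.Properties.Equivalence using () renaming (refl to ⇔-refl)
open import Function.Related.Propositional using (equivalence)
open import Level using (0ℓ)
open import Relation.Binary.PropositionalEquality
open import Relation.Nullary using (contradiction; yes; no)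

open import Algebra.Definitions {A = ℕ} _≡_ using (Commutative; Associative; RightIdentity; RightInverse)
open import Algebra.Structures {A = ℕ} _≡_ using (IsAbelianGroup)
open import Algebra.Properties.Group ℚ.+-0-group using (//-rightDividesˡ; //-rightDividesʳ)
open CommutativeSemigroupProperties (AbelianGroup.commutativeSemigroup ℚ.+-0-abelianGroup)
  using (xy∙z≈zx∙y)
open import Defs

bitXor : ℕ → ℕ → ℕ
bitXor p q = if p ≡ᵇ q then 0 else 1

bitXor≤1 : ∀ p q → bitXor p q ≤ 1
bitXor≤1 p q with p ≡ᵇ q
... | true  = z≤n
... | false = s≤s z≤n

bitXor-comm : ∀ p q → bitXor p q ≡ bitXor q p
bitXor-comm zero    zero    = refl
bitXor-comm zero    (suc q) = refl
bitXor-comm (suc p) zero    = refl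
bitXor-comm (suc p) (suc q) = bitXor-comm p q

bitXor-self : ∀ p → bitXor p p ≡ 0
bitXor-self zero    = refl
bitXor-self (suc p) = bitXor-self p

bitXor-identityʳ : ∀ {p} → p ≤ 1 → bitXor p 0 ≡ p
bitXor-identityʳ z≤n       = refl
bitXor-identityʳ (s≤s z≤n) = refl

bitXor-identityˡ : ∀ {p} → p ≤ 1 → bitXor 0 p ≡ p
bitXor-identityˡ {p} p≤1 = trans (bitXor-comm 0 p) (bitXor-identityʳ p≤1)

bitXor-assoc : ∀ {p q r} → p ≤ 1 → q ≤ 1 → r ≤ 1 →
               bitXor (bitXor p q) r ≡ bitXor p (bitXor q r)
bitXor-assoc z≤n       z≤n       z≤n       = refl
bitXor-assoc z≤n       z≤n       (s≤s z≤n) = refl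
bitXor-assoc z≤n       (s≤s z≤n) z≤n       = refl
bitXor-assoc z≤n       (s≤s z≤n) (s≤s z≤n) = refl
bitXor-assoc (s≤s z≤n) z≤n       z≤n       = refl
bitXor-assoc (s≤s z≤n) z≤n       (s≤s z≤n) = refl
bitXor-assoc (s≤s z≤n) (s≤s z≤n) z≤n       = refl
bitXor-assoc (s≤s z≤n) (s≤s z≤n) (s≤s z≤n) = refl

n%2≤1 : ∀ n → n % 2 ≤ 1
n%2≤1 n = s≤s⁻¹ (m%n<n n 2)

c+2*[1+q]≡2+[c+2*q] : ∀ c q → c + 2 * suc q ≡ 2 + (c + 2 * q)
c+2*[1+q]≡2+[c+2*q] = solve-∀

n≡n%2+2*⌊n/2⌋ : ∀ n → n ≡ n % 2 + 2 * ⌊ n /2⌋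
n≡n%2+2*⌊n/2⌋ zero          = refl
n≡n%2+2*⌊n/2⌋ (suc zero)    = refl
n≡n%2+2*⌊n/2⌋ (suc (suc n)) =
  trans (cong (2 +_) (n≡n%2+2*⌊n/2⌋ n)) (sym (c+2*[1+q]≡2+[c+2*q] (n % 2) ⌊ n /2⌋))

[c+2*q]%2≡c : ∀ {c} q → c ≤ 1 → (c + 2 * q) % 2 ≡ c
[c+2*q]%2≡c zero    z≤n       = refl
[c+2*q]%2≡c zero    (s≤s z≤n) = refl
[c+2*q]%2≡c {c} (suc q) c≤1 =
  trans (cong (_% 2) (c+2*[1+q]≡2+[c+2*q] c q)) ([c+2*q]%2≡c q c≤1)

⌊c+2*q/2⌋≡q : ∀ {c} q → c ≤ 1 → ⌊ c + 2 * q /2⌋ ≡ q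
⌊c+2*q/2⌋≡q zero    z≤n       = refl
⌊c+2*q/2⌋≡q zero    (s≤s z≤n) = refl
⌊c+2*q/2⌋≡q {c} (suc q) c≤1 =
  trans (cong ⌊_/2⌋ (c+2*[1+q]≡2+[c+2*q] c q)) (cong suc (⌊c+2*q/2⌋≡q q c≤1))

≡-by-halves : ∀ {m n} → m % 2 ≡ n % 2 → ⌊ m /2⌋ ≡ ⌊ n /2⌋ → m ≡ n
≡-by-halves {m} {n} low high = begin
  m                     ≡⟨ n≡n%2+2*⌊n/2⌋ m ⟩
  m % 2 + 2 * ⌊ m /2⌋   ≡⟨ cong₂ (λ c q → c + 2 * q) low high ⟩
  n % 2 + 2 * ⌊ n /2⌋   ≡⟨ n≡n%2+2*⌊n/2⌋ n ⟨
  n                     ∎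
  where open ≡-Reasoning

m≤1+n⇒⌊m/2⌋≤n : ∀ {m n} → m ≤ suc n → ⌊ m /2⌋ ≤ n
m≤1+n⇒⌊m/2⌋≤n {m} {n} m≤1+n = ≤-trans (⌊n/2⌋-mono m≤1+n) (s≤s⁻¹ (⌊n/2⌋<n n))

2*⌊n/2⌋≤n : ∀ n → 2 * ⌊ n /2⌋ ≤ n
2*⌊n/2⌋≤n n = ≤-trans (m≤n+m (2 * ⌊ n /2⌋) (n % 2)) (≤-reflexive (sym (n≡n%2+2*⌊n/2⌋ n)))

m<2*n⇒⌊m/2⌋<n : ∀ {m n} → m < 2 * n → ⌊ m /2⌋ < n
m<2*n⇒⌊m/2⌋<n {m} {n} m<2n = *-cancelˡ-< 2 ⌊ m /2⌋ n (≤-<-trans (2*⌊n/2⌋≤n m) m<2n)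

c+2*q<2*n : ∀ {c q n} → c ≤ 1 → q < n → c + 2 * q < 2 * n
c+2*q<2*n {c} {q} c≤1 q<n =
  ≤-trans (s≤s (+-monoˡ-≤ (2 * q) c≤1)) (≤-trans (≤-reflexive (sym (*-suc 2 q))) (*-monoʳ-≤ 2 q<n))

xorFuel-0-0 : ∀ f → xorFuel f 0 0 ≡ 0
xorFuel-0-0 zero    = refl
xorFuel-0-0 (suc f) = cong (2 *_) (xorFuel-0-0 f)

xorFuel-stable : ∀ {f g a b} → a ≤ f → b ≤ f → f ≤ g → xorFuel f a b ≡ xorFuel g a b
xorFuel-stable {zero}  {g} z≤n z≤n _ = sym (xorFuel-0-0 g)
xorFuel-stable {suc f} {suc g} {a} {b} a≤f b≤f (s≤s f≤g) =
  cong (λ r → bitXor (a % 2) (b % 2) + 2 * r)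
       (xorFuel-stable (m≤1+n⇒⌊m/2⌋≤n a≤f) (m≤1+n⇒⌊m/2⌋≤n b≤f) f≤g)

⊕-unfold : ∀ a b → a ⊕ b ≡ bitXor (a % 2) (b % 2) + 2 * (⌊ a /2⌋ ⊕ ⌊ b /2⌋)
⊕-unfold a b =
  trans (xorFuel-stable (m≤m+n a b) (m≤n+m b a) (n≤1+n (a + b)))
        (cong (λ r → bitXor (a % 2) (b % 2) + 2 * r)
              (sym (xorFuel-stable (m≤m+n _ _) (m≤n+m _ _) (+-mono-≤ (⌊n/2⌋≤n a) (⌊n/2⌋≤n b)))))

%2-distrib-⊕ : ∀ a b → (a ⊕ b) % 2 ≡ bitXor (a % 2) (b % 2)
%2-distrib-⊕ a b =
  trans (cong (_% 2) (⊕-unfold a b)) ([c+2*q]%2≡c (⌊ a /2⌋ ⊕ ⌊ b /2⌋) (bitXor≤1 (a % 2) (b % 2)))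

⌊/2⌋-distrib-⊕ : ∀ a b → ⌊ a ⊕ b /2⌋ ≡ ⌊ a /2⌋ ⊕ ⌊ b /2⌋
⌊/2⌋-distrib-⊕ a b =
  trans (cong ⌊_/2⌋ (⊕-unfold a b)) (⌊c+2*q/2⌋≡q (⌊ a /2⌋ ⊕ ⌊ b /2⌋) (bitXor≤1 (a % 2) (b % 2)))

⊕-comm-≤ : ∀ n {a b} → a ≤ n → b ≤ n → a ⊕ b ≡ b ⊕ a
⊕-comm-≤ zero    z≤n z≤n = refl
⊕-comm-≤ (suc n) {a} {b} a≤ b≤ = ≡-by-halves
  (begin
    (a ⊕ b) % 2               ≡⟨ %2-distrib-⊕ a b ⟩
    bitXor (a % 2) (b % 2)    ≡⟨ bitXor-comm (a % 2) (b % 2) ⟩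
    bitXor (b % 2) (a % 2)    ≡⟨ %2-distrib-⊕ b a ⟨
    (b ⊕ a) % 2               ∎)
  (begin
    ⌊ a ⊕ b /2⌋               ≡⟨ ⌊/2⌋-distrib-⊕ a b ⟩
    ⌊ a /2⌋ ⊕ ⌊ b /2⌋         ≡⟨ ⊕-comm-≤ n (m≤1+n⇒⌊m/2⌋≤n a≤) (m≤1+n⇒⌊m/2⌋≤n b≤) ⟩
    ⌊ b /2⌋ ⊕ ⌊ a /2⌋         ≡⟨ ⌊/2⌋-distrib-⊕ b a ⟨
    ⌊ b ⊕ a /2⌋               ∎)
  where open ≡-Reasoning

⊕-assoc-≤ : ∀ n {a b c} → a ≤ n → b ≤ n → c ≤ n → (a ⊕ b) ⊕ c ≡ a ⊕ (b ⊕ c)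
⊕-assoc-≤ zero    z≤n z≤n z≤n = refl
⊕-assoc-≤ (suc n) {a} {b} {c} a≤ b≤ c≤ = ≡-by-halves
  (begin
    ((a ⊕ b) ⊕ c) % 2                          ≡⟨ %2-distrib-⊕ (a ⊕ b) c ⟩
    bitXor ((a ⊕ b) % 2) (c % 2)               ≡⟨ cong (λ r → bitXor r (c % 2)) (%2-distrib-⊕ a b) ⟩
    bitXor (bitXor (a % 2) (b % 2)) (c % 2)    ≡⟨ bitXor-assoc (n%2≤1 a) (n%2≤1 b) (n%2≤1 c) ⟩
    bitXor (a % 2) (bitXor (b % 2) (c % 2))    ≡⟨ cong (bitXor (a % 2)) (%2-distrib-⊕ b c) ⟨
    bitXor (a % 2) ((b ⊕ c) % 2)               ≡⟨ %2-distrib-⊕ a (b ⊕ c) ⟨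
    (a ⊕ (b ⊕ c)) % 2                          ∎)
  (begin
    ⌊ (a ⊕ b) ⊕ c /2⌋                          ≡⟨ ⌊/2⌋-distrib-⊕ (a ⊕ b) c ⟩
    ⌊ a ⊕ b /2⌋ ⊕ ⌊ c /2⌋                      ≡⟨ cong (_⊕ ⌊ c /2⌋) (⌊/2⌋-distrib-⊕ a b) ⟩
    (⌊ a /2⌋ ⊕ ⌊ b /2⌋) ⊕ ⌊ c /2⌋              ≡⟨ ⊕-assoc-≤ n (m≤1+n⇒⌊m/2⌋≤n a≤) (m≤1+n⇒⌊m/2⌋≤n b≤)
                                                               (m≤1+n⇒⌊m/2⌋≤n c≤) ⟩
    ⌊ a /2⌋ ⊕ (⌊ b /2⌋ ⊕ ⌊ c /2⌋)              ≡⟨ cong (⌊ a /2⌋ ⊕_) (⌊/2⌋-distrib-⊕ b c) ⟨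
    ⌊ a /2⌋ ⊕ ⌊ b ⊕ c /2⌋                      ≡⟨ ⌊/2⌋-distrib-⊕ a (b ⊕ c) ⟨
    ⌊ a ⊕ (b ⊕ c) /2⌋                          ∎)
  where open ≡-Reasoning

⊕-identityʳ-≤ : ∀ n {a} → a ≤ n → a ⊕ 0 ≡ a
⊕-identityʳ-≤ zero    z≤n = refl
⊕-identityʳ-≤ (suc n) {a} a≤ = ≡-by-halves
  (trans (%2-distrib-⊕ a 0) (bitXor-identityʳ (n%2≤1 a)))
  (trans (⌊/2⌋-distrib-⊕ a 0) (⊕-identityʳ-≤ n (m≤1+n⇒⌊m/2⌋≤n a≤)))

⊕-self-≤ : ∀ n {a} → a ≤ n → a ⊕ a ≡ 0
⊕-self-≤ zero    z≤n = refl
⊕-self-≤ (suc n) {a} a≤ = ≡-by-halves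
  (trans (%2-distrib-⊕ a a) (bitXor-self (a % 2)))
  (trans (⌊/2⌋-distrib-⊕ a a) (⊕-self-≤ n (m≤1+n⇒⌊m/2⌋≤n a≤)))

⊕-comm : Commutative _⊕_
⊕-comm a b = ⊕-comm-≤ (a + b) (m≤m+n a b) (m≤n+m b a)

⊕-assoc : Associative _⊕_
⊕-assoc a b c = ⊕-assoc-≤ (a + b + c)
  (≤-trans (m≤m+n a b) (m≤m+n (a + b) c)) (≤-trans (m≤n+m b a) (m≤m+n (a + b) c)) (m≤n+m c (a + b))

⊕-identityʳ : RightIdentity 0 _⊕_
⊕-identityʳ a = ⊕-identityʳ-≤ a ≤-refl

⊕-inverseʳ : RightInverse 0 id _⊕_
⊕-inverseʳ a = ⊕-self-≤ a ≤-refl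

⊕-isAbelianGroup : IsAbelianGroup _⊕_ 0 id
⊕-isAbelianGroup = record
  { isGroup = record
    { isMonoid = record
      { isSemigroup = record
        { isMagma = record { isEquivalence = isEquivalence ; ∙-cong = cong₂ _⊕_ }
        ; assoc   = ⊕-assoc
        }
      ; identity = comm∧idʳ⇒id ⊕-comm ⊕-identityʳ
      }
    ; inverse = comm∧invʳ⇒inv ⊕-comm ⊕-inverseʳ
    ; ⁻¹-cong = cong id
    }
  ; comm = ⊕-comm
  }

⊕-abelianGroup : AbelianGroup 0ℓ 0ℓ
⊕-abelianGroup = record { isAbelianGroup = ⊕-isAbelianGroup }

open AbelianGroupProperties ⊕-abelianGroup using (inverseˡ-unique; \\-leftDividesˡ)
open CommutativeSemigroupProperties (AbelianGroup.commutativeSemigroup ⊕-abelianGroup)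
  using (interchange)

2^e+x≡2^e⊕x : ∀ e {x} → x < 2 ^ e → 2 ^ e + x ≡ 2 ^ e ⊕ x
2^e+x≡2^e⊕x zero    {zero}  _         = refl
2^e+x≡2^e⊕x zero    {suc _} (s≤s ())
2^e+x≡2^e⊕x (suc e) {x} x<2^e = ≡-by-halves
  (begin
    (2 ^ suc e + x) % 2                  ≡⟨ cong (_% 2) split ⟩
    (x % 2 + 2 * (2 ^ e + ⌊ x /2⌋)) % 2  ≡⟨ [c+2*q]%2≡c (2 ^ e + ⌊ x /2⌋) (n%2≤1 x) ⟩
    x % 2                                ≡⟨ bitXor-identityˡ (n%2≤1 x) ⟨
    bitXor 0 (x % 2)                     ≡⟨ cong (λ b → bitXor b (x % 2)) ([c+2*q]%2≡c (2 ^ e) z≤n) ⟨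
    bitXor (2 ^ suc e % 2) (x % 2)       ≡⟨ %2-distrib-⊕ (2 ^ suc e) x ⟨
    (2 ^ suc e ⊕ x) % 2                  ∎)
  (begin
    ⌊ 2 ^ suc e + x /2⌋                  ≡⟨ cong ⌊_/2⌋ split ⟩
    ⌊ x % 2 + 2 * (2 ^ e + ⌊ x /2⌋) /2⌋  ≡⟨ ⌊c+2*q/2⌋≡q (2 ^ e + ⌊ x /2⌋) (n%2≤1 x) ⟩
    2 ^ e + ⌊ x /2⌋                      ≡⟨ 2^e+x≡2^e⊕x e (m<2*n⇒⌊m/2⌋<n x<2^e) ⟩
    2 ^ e ⊕ ⌊ x /2⌋                      ≡⟨ cong (_⊕ ⌊ x /2⌋) (⌊c+2*q/2⌋≡q (2 ^ e) z≤n) ⟨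
    ⌊ 2 ^ suc e /2⌋ ⊕ ⌊ x /2⌋            ≡⟨ ⌊/2⌋-distrib-⊕ (2 ^ suc e) x ⟨
    ⌊ 2 ^ suc e ⊕ x /2⌋                  ∎)
  where
  open ≡-Reasoning
  rearrange : ∀ n c q → 2 * n + (c + 2 * q) ≡ c + 2 * (n + q)
  rearrange = solve-∀
  split : 2 ^ suc e + x ≡ x % 2 + 2 * (2 ^ e + ⌊ x /2⌋)
  split = trans (cong (2 ^ suc e +_) (n≡n%2+2*⌊n/2⌋ x)) (rearrange (2 ^ e) (x % 2) ⌊ x /2⌋)

⊕-<-2^ : ∀ e {x y} → x < 2 ^ e → y < 2 ^ e → x ⊕ y < 2 ^ e
⊕-<-2^ zero    {zero}  {zero}  _          _          = s≤s z≤n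
⊕-<-2^ zero    {suc _} {_}     (s≤s ())   _
⊕-<-2^ zero    {_}     {suc _} _          (s≤s ())
⊕-<-2^ (suc e) {x}    {y}    x<2^e y<2^e = subst (_< 2 ^ suc e) (sym (⊕-unfold x y))
  (c+2*q<2*n (bitXor≤1 (x % 2) (y % 2))
             (⊕-<-2^ e (m<2*n⇒⌊m/2⌋<n x<2^e) (m<2*n⇒⌊m/2⌋<n y<2^e)))

odd-sum-of-bits : ∀ {c d n k} → c ≤ 1 → d ≤ 1 → suc (c + d + 2 * n) ≡ 2 * k →
                  bitXor c d ≡ c + d × suc n ≡ k
odd-sum-of-bits {n = n} {k} z≤n       z≤n       eq = contradiction (sym eq) (even≢odd k n)
odd-sum-of-bits {n = n} {k} z≤n       (s≤s z≤n) eq = refl , *-cancelˡ-≡ (suc n) k 2 (trans (*-suc 2 n) eq)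
odd-sum-of-bits {n = n} {k} (s≤s z≤n) z≤n       eq = refl , *-cancelˡ-≡ (suc n) k 2 (trans (*-suc 2 n) eq)
odd-sum-of-bits {n = n} {k} (s≤s z≤n) (s≤s z≤n) eq =
  contradiction (sym (trans (cong suc (*-suc 2 n)) eq)) (even≢odd k (suc n))

⊕-complement : ∀ e x y → suc (x + y) ≡ 2 ^ e → x ⊕ y ≡ x + y
⊕-complement zero    zero    zero    _  = refl
⊕-complement (suc e) x       y       eq = begin
  x ⊕ y                                              ≡⟨ ⊕-unfold x y ⟩
  bitXor (x % 2) (y % 2) + 2 * (⌊ x /2⌋ ⊕ ⌊ y /2⌋)   ≡⟨ cong₂ (λ c h → c + 2 * h) (proj₁ odd) (⊕-complement e ⌊ x /2⌋ ⌊ y /2⌋ (proj₂ odd)) ⟩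
  x % 2 + y % 2 + 2 * (⌊ x /2⌋ + ⌊ y /2⌋)            ≡⟨ split ⟨
  x + y                                              ∎
  where
  open ≡-Reasoning
  rearrange : ∀ c q d r → (c + 2 * q) + (d + 2 * r) ≡ c + d + 2 * (q + r)
  rearrange = solve-∀
  split : x + y ≡ x % 2 + y % 2 + 2 * (⌊ x /2⌋ + ⌊ y /2⌋)
  split = trans (cong₂ _+_ (n≡n%2+2*⌊n/2⌋ x) (n≡n%2+2*⌊n/2⌋ y))
                (rearrange (x % 2) ⌊ x /2⌋ (y % 2) ⌊ y /2⌋)
  odd : bitXor (x % 2) (y % 2) ≡ x % 2 + y % 2 × suc (⌊ x /2⌋ + ⌊ y /2⌋) ≡ 2 ^ e
  odd = odd-sum-of-bits (n%2≤1 x) (n%2≤1 y) (trans (cong suc (sym split)) eq)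

[2^e+x]⊕y≡2^e+[x⊕y] : ∀ e {x y} → x < 2 ^ e → y < 2 ^ e → (2 ^ e + x) ⊕ y ≡ 2 ^ e + (x ⊕ y)
[2^e+x]⊕y≡2^e+[x⊕y] e {x} {y} x<2^e y<2^e = begin
  (2 ^ e + x) ⊕ y    ≡⟨ cong (_⊕ y) (2^e+x≡2^e⊕x e x<2^e) ⟩
  (2 ^ e ⊕ x) ⊕ y    ≡⟨ ⊕-assoc (2 ^ e) x y ⟩
  2 ^ e ⊕ (x ⊕ y)    ≡⟨ 2^e+x≡2^e⊕x e (⊕-<-2^ e x<2^e y<2^e) ⟨
  2 ^ e + (x ⊕ y)    ∎
  where open ≡-Reasoning

x⊕[2^e+y]≡2^e+[x⊕y] : ∀ e {x y} → x < 2 ^ e → y < 2 ^ e → x ⊕ (2 ^ e + y) ≡ 2 ^ e + (x ⊕ y)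
x⊕[2^e+y]≡2^e+[x⊕y] e {x} {y} x<2^e y<2^e = begin
  x ⊕ (2 ^ e + y)    ≡⟨ ⊕-comm x (2 ^ e + y) ⟩
  (2 ^ e + y) ⊕ x    ≡⟨ [2^e+x]⊕y≡2^e+[x⊕y] e y<2^e x<2^e ⟩
  2 ^ e + (y ⊕ x)    ≡⟨ cong (2 ^ e +_) (⊕-comm y x) ⟩
  2 ^ e + (x ⊕ y)    ∎
  where open ≡-Reasoning

[b+a]⊕[b+c]≡a⊕c : ∀ e a b c → suc (a + b + c) ≡ 2 ^ e → (b + a) ⊕ (b + c) ≡ a ⊕ c
[b+a]⊕[b+c]≡a⊕c e a b c 1+a+b+c≡2^e = begin
  (b + a) ⊕ (b + c)    ≡⟨ cong₂ _⊕_ (complement c (b + a) (rearrange a b c))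
                                  (complement a (b + c) (sym (+-assoc a b c))) ⟩
  (c ⊕ M) ⊕ (a ⊕ M)    ≡⟨ interchange c M a M ⟩
  (c ⊕ a) ⊕ (M ⊕ M)    ≡⟨ cong ((c ⊕ a) ⊕_) (⊕-inverseʳ M) ⟩
  (c ⊕ a) ⊕ 0          ≡⟨ ⊕-identityʳ (c ⊕ a) ⟩
  c ⊕ a                ≡⟨ ⊕-comm c a ⟩
  a ⊕ c                ∎
  where
  open ≡-Reasoning
  M = a + b + c
  rearrange : ∀ a b c → c + (b + a) ≡ a + b + c
  rearrange = solve-∀
  complement : ∀ x y → x + y ≡ M → y ≡ x ⊕ M
  complement x y x+y≡M = begin
    y              ≡⟨ \\-leftDividesˡ x y ⟨
    x ⊕ (x ⊕ y)    ≡⟨ cong (x ⊕_) (⊕-complement e x y (trans (cong suc x+y≡M) 1+a+b+c≡2^e)) ⟩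
    x ⊕ (x + y)    ≡⟨ cong (x ⊕_) x+y≡M ⟩
    x ⊕ M          ∎

⊕≡0⇔≡ : ∀ {x y} → x ⊕ y ≡ 0 ⇔ x ≡ y
⊕≡0⇔≡ {x} = mk⇔ (inverseˡ-unique x _) (λ { refl → ⊕-inverseʳ x })

sideXor : ℕ → ℕ → ℕ
sideXor n i = (i ∸ 1) ⊕ (n ∸ i)

P-xor-interchange : ∀ n i j →
  (i ∸ 1) ⊕ (j ∸ 1) ⊕ (n ∸ i) ⊕ (n ∸ j) ≡ sideXor n i ⊕ sideXor n j
P-xor-interchange n i j =
  trans (⊕-assoc ((i ∸ 1) ⊕ (j ∸ 1)) (n ∸ i) (n ∸ j)) (interchange (i ∸ 1) (j ∸ 1) (n ∸ i) (n ∸ j))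

P-intro : ∀ {n i j} → 1 ≤ i × i ≤ n → 1 ≤ j × j ≤ n → sideXor n i ≡ sideXor n j → P n i j
P-intro {n} {i} {j} (1≤i , i≤n) (1≤j , j≤n) eq =
  1≤i , i≤n , 1≤j , j≤n , trans (P-xor-interchange n i j) (from ⊕≡0⇔≡ eq)

P⇒sideXor≡ : ∀ {n i j} → P n i j → sideXor n i ≡ sideXor n j
P⇒sideXor≡ {n} {i} {j} (_ , _ , _ , _ , eq) =
  to ⊕≡0⇔≡ (trans (sym (P-xor-interchange n i j)) eq)

sideXor<2^ : ∀ e {n i} → 1 ≤ i → i ≤ n → n ≤ 2 ^ e → sideXor n i < 2 ^ e
sideXor<2^ e {n} {suc _} 1≤i i≤n n≤2^e =
  ⊕-<-2^ e (≤-trans i≤n n≤2^e) (<-≤-trans (∸-monoʳ-< 1≤i i≤n) n≤2^e)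

ℚ[]-homo-+ : ∀ a b → ℚ[ a + b ] ≡ ℚ[ a ] +ℚ ℚ[ b ]
ℚ[]-homo-+ a b = ℚ.toℚᵘ-injective (begin
  toℚᵘ ℚ[ a + b ]                      ≈⟨ ℚ.toℚᵘ-fromℚᵘ (mkℚᵘ (ℤ.+ (a + b)) 0) ⟩
  mkℚᵘ (ℤ.+ (a + b)) 0                 ≈⟨ *≡* integers ⟩
  mkℚᵘ (ℤ.+ a) 0 ℚᵘ.+ mkℚᵘ (ℤ.+ b) 0   ≈⟨ ℚᵘ.+-cong (ℚ.toℚᵘ-fromℚᵘ (mkℚᵘ (ℤ.+ a) 0))
                                                   (ℚ.toℚᵘ-fromℚᵘ (mkℚᵘ (ℤ.+ b) 0)) ⟨
  toℚᵘ ℚ[ a ] ℚᵘ.+ toℚᵘ ℚ[ b ]         ≈⟨ ℚ.toℚᵘ-homo-+ ℚ[ a ] ℚ[ b ] ⟨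
  toℚᵘ (ℚ[ a ] +ℚ ℚ[ b ])              ∎)
  where
  open ℚᵘ.≃-Reasoning
  integers : ℤ.+ (a + b) ℤ.* ℤ.+ 1 ≡ (ℤ.+ a ℤ.* ℤ.+ 1 ℤ.+ ℤ.+ b ℤ.* ℤ.+ 1) ℤ.* ℤ.+ 1
  integers rewrite ℤ.*-identityʳ (ℤ.+ a) | ℤ.*-identityʳ (ℤ.+ b) | ℤ.*-identityʳ (ℤ.+ (a + b)) = refl

≤-⇔+≤ : ∀ {a x} c → a ≤ℚ x -ℚ c ⇔ a +ℚ c ≤ℚ x
≤-⇔+≤ {a} {x} c = mk⇔
  (λ a≤x-c → subst (a +ℚ c ≤ℚ_) (//-rightDividesˡ c x) (ℚ.+-monoˡ-≤ c a≤x-c))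
  (λ a+c≤x → subst (_≤ℚ x -ℚ c) (//-rightDividesʳ c a) (ℚ.+-monoˡ-≤ (-ℚ c) a+c≤x))

-≤⇔≤+ : ∀ {x b} c → x -ℚ c ≤ℚ b ⇔ x ≤ℚ b +ℚ c
-≤⇔≤+ {x} {b} c = mk⇔
  (λ x-c≤b → subst (_≤ℚ b +ℚ c) (//-rightDividesˡ c x) (ℚ.+-monoˡ-≤ c x-c≤b))
  (λ x≤b+c → subst (x -ℚ c ≤ℚ_) (//-rightDividesʳ c b) (ℚ.+-monoˡ-≤ (-ℚ c) x≤b+c))

lower-translate : ∀ p i {x} → ℚ[ i ] -ℚ ℚ[ 1 ] ≤ℚ x -ℚ ℚ[ p ] ⇔ ℚ[ p + i ] -ℚ ℚ[ 1 ] ≤ℚ x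
lower-translate p i {x} = subst (λ l → ℚ[ i ] -ℚ ℚ[ 1 ] ≤ℚ x -ℚ ℚ[ p ] ⇔ l ≤ℚ x) shift (≤-⇔+≤ ℚ[ p ])
  where
  shift : ℚ[ i ] -ℚ ℚ[ 1 ] +ℚ ℚ[ p ] ≡ ℚ[ p + i ] -ℚ ℚ[ 1 ]
  shift = trans (xy∙z≈zx∙y ℚ[ i ] (-ℚ ℚ[ 1 ]) ℚ[ p ]) (cong (_-ℚ ℚ[ 1 ]) (sym (ℚ[]-homo-+ p i)))

upper-translate : ∀ p i {x} → x -ℚ ℚ[ p ] ≤ℚ ℚ[ i ] ⇔ x ≤ℚ ℚ[ p + i ]
upper-translate p i {x} = subst (λ u → x -ℚ ℚ[ p ] ≤ℚ ℚ[ i ] ⇔ x ≤ℚ u) shift (-≤⇔≤+ ℚ[ p ])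
  where
  shift : ℚ[ i ] +ℚ ℚ[ p ] ≡ ℚ[ p + i ]
  shift = trans (ℚ.+-comm ℚ[ i ] ℚ[ p ]) (sym (ℚ[]-homo-+ p i))

-- R n x y unfolds definitionally to ∃₂ λ i j → P n i j × Square i j x y.
Square : ℕ → ℕ → ℚ → ℚ → Set
Square i j x y = (ℚ[ i ] -ℚ ℚ[ 1 ] ≤ℚ x) × (x ≤ℚ ℚ[ i ]) × (ℚ[ j ] -ℚ ℚ[ 1 ] ≤ℚ y) × (y ≤ℚ ℚ[ j ])

Square-translate : ∀ p q i j {x y} →
  Square i j (x -ℚ ℚ[ p ]) (y -ℚ ℚ[ q ]) ⇔ Square (p + i) (q + j) x y
Square-translate p q i j =
  lower-translate p i ×-⇔ upper-translate p i ×-⇔ lower-translate q j ×-⇔ upper-translate q j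

R-translate : ∀ n p q {x y} →
  (R n +[ p , q ]) x y ⇔ (∃₂ λ i j → P n i j × Square (p + i) (q + j) x y)
R-translate n p q = Σ.congˡ {k = equivalence} λ {i} → Σ.congˡ {k = equivalence} λ {j} →
  ⇔-refl ×-⇔ Square-translate p q i j

module Decomposition (e : ℕ) {s : ℕ} (s<2^e : s < 2 ^ e) where

  N t m : ℕ
  N = 2 ^ e
  t = N ∸ s
  m = s + N

  offset : Bool → ℕ
  offset false = 0
  offset true  = N

  data Row : ℕ → Set where
    outer : ∀ b {i} → 1 ≤ i → i ≤ s → Row (offset b + i)
    inner : ∀ {i} → 1 ≤ i → i ≤ t → Row (s + i)

  row : ∀ {i} → 1 ≤ i → i ≤ m → Row i
  row {i} 1≤i i≤m with i ≤? s | i ≤? N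
  ... | yes i≤s | _       = outer false 1≤i i≤s
  ... | no  i≰s | yes i≤N =
    subst Row (m+[n∸m]≡n (<⇒≤ s<i)) (inner (m<n⇒0<n∸m s<i) (∸-monoˡ-≤ s i≤N))
    where s<i = ≰⇒> i≰s
  ... | no  _   | no  i≰N =
    subst Row (m+[n∸m]≡n (<⇒≤ N<i)) (outer true (m<n⇒0<n∸m N<i) (m≤n+o⇒m∸n≤o i N i≤N+s))
    where
    N<i   = ≰⇒> i≰N
    i≤N+s = subst (i ≤_) (+-comm s N) i≤m

  Row-bounds : ∀ {i} → Row i → 1 ≤ i × i ≤ m
  Row-bounds (outer false 1≤i i≤s) =
    1≤i , ≤-trans i≤s (m≤m+n s N)
  Row-bounds (outer true {i} 1≤i i≤s) =
    ≤-trans 1≤i (m≤n+m i N) , subst (N + i ≤_) (+-comm N s) (+-monoʳ-≤ N i≤s)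
  Row-bounds (inner {i} 1≤i i≤t) =
    ≤-trans 1≤i (m≤n+m i s) , +-monoʳ-≤ s (≤-trans i≤t (m∸n≤m N s))

  i∸1<N : ∀ {i} → i ≤ s → i ∸ 1 < N
  i∸1<N {i} i≤s = ≤-<-trans (≤-trans (m∸n≤m i 1) i≤s) s<2^e

  s∸i<N : ∀ i → s ∸ i < N
  s∸i<N i = ≤-<-trans (m∸n≤m s i) s<2^e

  sideXor-outer : ∀ b {i} → 1 ≤ i → i ≤ s → sideXor m (offset b + i) ≡ N + sideXor s i
  sideXor-outer false {i} 1≤i i≤s = begin
    (i ∸ 1) ⊕ (s + N ∸ i)     ≡⟨ cong ((i ∸ 1) ⊕_) (trans (+-∸-comm N i≤s) (+-comm (s ∸ i) N)) ⟩
    (i ∸ 1) ⊕ (N + (s ∸ i))   ≡⟨ x⊕[2^e+y]≡2^e+[x⊕y] e (i∸1<N i≤s) (s∸i<N i) ⟩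
    N + sideXor s i           ∎
    where open ≡-Reasoning
  sideXor-outer true  {i} 1≤i i≤s = begin
    (N + i ∸ 1) ⊕ (s + N ∸ (N + i))   ≡⟨ cong₂ _⊕_ (+-∸-assoc N 1≤i)
                                                   (trans (cong (_∸ (N + i)) (+-comm s N)) ([m+n]∸[m+o]≡n∸o N s i)) ⟩
    (N + (i ∸ 1)) ⊕ (s ∸ i)           ≡⟨ [2^e+x]⊕y≡2^e+[x⊕y] e (i∸1<N i≤s) (s∸i<N i) ⟩
    N + sideXor s i                   ∎
    where open ≡-Reasoning

  sideXor-inner : ∀ {i} → 1 ≤ i → i ≤ t → sideXor m (s + i) ≡ sideXor t i
  sideXor-inner {suc a} _ i≤t = begin
    (s + suc a ∸ 1) ⊕ (m ∸ (s + suc a))   ≡⟨ cong₂ _⊕_ (+-∸-assoc s (s≤s z≤n)) m∸[s+i]≡s+w ⟩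
    (s + a) ⊕ (s + w)                     ≡⟨ [b+a]⊕[b+c]≡a⊕c e a s w 1+a+s+w≡N ⟩
    a ⊕ w                                 ∎
    where
    open ≡-Reasoning
    w = t ∸ suc a
    N≡s+[1+a+w] : N ≡ s + (suc a + w)
    N≡s+[1+a+w] = trans (sym (m+[n∸m]≡n (<⇒≤ s<2^e))) (cong (s +_) (sym (m+[n∸m]≡n i≤t)))
    rearrange₁ : ∀ s a w → s + (suc a + w) ≡ suc a + (s + w)
    rearrange₁ = solve-∀
    rearrange₂ : ∀ s a w → suc (a + s + w) ≡ s + (suc a + w)
    rearrange₂ = solve-∀
    m∸[s+i]≡s+w : m ∸ (s + suc a) ≡ s + w
    m∸[s+i]≡s+w = begin
      s + N ∸ (s + suc a)         ≡⟨ [m+n]∸[m+o]≡n∸o s N (suc a) ⟩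
      N ∸ suc a                   ≡⟨ cong (_∸ suc a) (trans N≡s+[1+a+w] (rearrange₁ s a w)) ⟩
      suc a + (s + w) ∸ suc a     ≡⟨ m+n∸m≡n (suc a) (s + w) ⟩
      s + w                       ∎
    1+a+s+w≡N : suc (a + s + w) ≡ 2 ^ e
    1+a+s+w≡N = trans (rearrange₂ s a w) (sym N≡s+[1+a+w])

  outer≢inner : ∀ b {i j} → 1 ≤ i → i ≤ s → 1 ≤ j → j ≤ t → sideXor m (offset b + i) ≢ sideXor m (s + j)
  outer≢inner b {i} {j} 1≤i i≤s 1≤j j≤t eq = m+n≮m N (sideXor s i) (begin-strict
    N + sideXor s i              ≡⟨ sideXor-outer b 1≤i i≤s ⟨
    sideXor m (offset b + i)     ≡⟨ eq ⟩
    sideXor m (s + j)            ≡⟨ sideXor-inner 1≤j j≤t ⟩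
    sideXor t j                  <⟨ sideXor<2^ e 1≤j j≤t (m∸n≤m N s) ⟩
    N                            ∎)
    where open ≤-Reasoning

  data Block : ℕ → ℕ → Set where
    corner : ∀ b₁ b₂ {i j} → P s i j → Block (offset b₁ + i) (offset b₂ + j)
    centre : ∀ {i j} → P t i j → Block (s + i) (s + j)

  Block⇒P : ∀ {i j} → Block i j → P m i j
  Block⇒P (corner b₁ b₂ {i} {j} p@(1≤i , i≤s , 1≤j , j≤s , _)) =
    P-intro (Row-bounds (outer b₁ 1≤i i≤s)) (Row-bounds (outer b₂ 1≤j j≤s)) (begin
      sideXor m (offset b₁ + i)   ≡⟨ sideXor-outer b₁ 1≤i i≤s ⟩
      N + sideXor s i             ≡⟨ cong (N +_) (P⇒sideXor≡ p) ⟩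
      N + sideXor s j             ≡⟨ sideXor-outer b₂ 1≤j j≤s ⟨
      sideXor m (offset b₂ + j)   ∎)
    where open ≡-Reasoning
  Block⇒P (centre {i} {j} p@(1≤i , i≤t , 1≤j , j≤t , _)) =
    P-intro (Row-bounds (inner 1≤i i≤t)) (Row-bounds (inner 1≤j j≤t)) (begin
      sideXor m (s + i)   ≡⟨ sideXor-inner 1≤i i≤t ⟩
      sideXor t i         ≡⟨ P⇒sideXor≡ p ⟩
      sideXor t j         ≡⟨ sideXor-inner 1≤j j≤t ⟨
      sideXor m (s + j)   ∎)
    where open ≡-Reasoning

  block : ∀ {i j} → Row i → Row j → sideXor m i ≡ sideXor m j → Block i j
  block (outer b₁ 1≤i i≤s) (outer b₂ 1≤j j≤s) eq = corner b₁ b₂ (P-intro (1≤i , i≤s) (1≤j , j≤s)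
    (+-cancelˡ-≡ N _ _ (trans (sym (sideXor-outer b₁ 1≤i i≤s)) (trans eq (sideXor-outer b₂ 1≤j j≤s)))))
  block (inner 1≤i i≤t) (inner 1≤j j≤t) eq = centre (P-intro (1≤i , i≤t) (1≤j , j≤t)
    (trans (sym (sideXor-inner 1≤i i≤t)) (trans eq (sideXor-inner 1≤j j≤t))))
  block (outer b 1≤i i≤s) (inner 1≤j j≤t) eq = ⊥-elim (outer≢inner b 1≤i i≤s 1≤j j≤t eq)
  block (inner 1≤i i≤t) (outer b 1≤j j≤s) eq = ⊥-elim (outer≢inner b 1≤j j≤s 1≤i i≤t (sym eq))

  P⇒Block : ∀ {i j} → P m i j → Block i j
  P⇒Block p@(1≤i , i≤m , 1≤j , j≤m , _) = block (row 1≤i i≤m) (row 1≤j j≤m) (P⇒sideXor≡ p)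

  CornersAndCentre : ℚ → ℚ → Set
  CornersAndCentre x y = R s x y ⊎ (R s +[ N , 0 ]) x y ⊎ (R s +[ 0 , N ]) x y
                         ⊎ (R s +[ N , N ]) x y ⊎ (R t +[ s , s ]) x y

  R-decomposition : ∀ {x y} → R m x y ⇔ CornersAndCentre x y
  R-decomposition {x} {y} = mk⇔ (λ (_ , _ , p , sq) → piece (P⇒Block p) sq) glue
    where
    piece : ∀ {i j} → Block i j → Square i j x y → CornersAndCentre x y
    piece (corner false false p) sq = inj₁ (_ , _ , p , sq)
    piece (corner true  false p) sq = inj₂ (inj₁ (from (R-translate s N 0) (_ , _ , p , sq)))
    piece (corner false true  p) sq = inj₂ (inj₂ (inj₁ (from (R-translate s 0 N) (_ , _ , p , sq))))
    piece (corner true  true  p) sq = inj₂ (inj₂ (inj₂ (inj₁ (from (R-translate s N N) (_ , _ , p , sq)))))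
    piece (centre p)             sq = inj₂ (inj₂ (inj₂ (inj₂ (from (R-translate t s s) (_ , _ , p , sq)))))

    corner-cell : ∀ b₁ b₂ → (∃₂ λ i j → P s i j × Square (offset b₁ + i) (offset b₂ + j) x y) → R m x y
    corner-cell b₁ b₂ (_ , _ , p , sq) = _ , _ , Block⇒P (corner b₁ b₂ p) , sq

    centre-cell : (∃₂ λ i j → P t i j × Square (s + i) (s + j) x y) → R m x y
    centre-cell (_ , _ , p , sq) = _ , _ , Block⇒P (centre p) , sq

    glue : CornersAndCentre x y → R m x y
    glue (inj₁ r)                      = corner-cell false false r
    glue (inj₂ (inj₁ r))               = corner-cell true  false (to (R-translate s N 0) r)
    glue (inj₂ (inj₂ (inj₁ r)))        = corner-cell false true  (to (R-translate s 0 N) r)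
    glue (inj₂ (inj₂ (inj₂ (inj₁ r)))) = corner-cell true  true  (to (R-translate s N N) r)
    glue (inj₂ (inj₂ (inj₂ (inj₂ r)))) = centre-cell (to (R-translate t s s) r)

theorem3 : (m k s : ℕ) → 2 ≤ m → s < 2 ^ (suc k) → m ≡ s + 2 ^ (suc k) →
    (x y : ℚ) →
      R m x y ⇔ (R s x y ⊎ (R s +[ m ∸ s , 0 ]) x y ⊎ (R s +[ 0 , m ∸ s ]) x y
                 ⊎ (R s +[ m ∸ s , m ∸ s ]) x y ⊎ (R (2 ^ (suc k) ∸ s) +[ s , s ]) x y)
theorem3 _ k s _ s<2^[1+k] refl x y rewrite m+n∸m≡n s (2 ^ suc k) =
  Decomposition.R-decomposition (suc k) s<2^[1+k]
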